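{- Fix a positive integer $n$ and consider the Zeckendorf Game started from $\{F_1^n\}$. The shortest possible game (achieved by a greedy algorithm) reaches the Zeckendorf decomposition of $n$ in exactly $n-Z(n)$ moves, where $Z(n)$ is the number of terms in the Zeckendorf decomposition of $n$. Moreover, every game has at most $i\cdot n$ moves, where $i$ is the index of the largest Fibonacci number $F_i$ with $F_i\le n$.
   Context: Fibonacci numbers are indexed as $F_1=1$, $F_2=2$, $F_{i+1}=F_i+F_{i-1}$. The Zeckendorf decomposition of $n$ is its unique representation as a sum of distinct, pairwise non-adjacent Fibonacci numbers in this indexing. The Zeckendorf Game on $n$: the state is an unordered multiset of Fibonacci numbers summing to $n$, initially $n$ copies of $F_1$. Players alternate; a move is one of: (1) replace $F_{i-1},F_i$ by $F_{i+1}$; (2a) replace $F_1,F_1$ by $F_2$; (2b) replace $F_2,F_2$ by $F_1,F_3$; (2c) for $i\ge3$, replace $F_i,F_i$ by $F_{i-2},F_{i+1}$. A game is a sequence of legal moves from the initial state until no legal move remains (at which point the state is the Zeckendorf decomposition); its length is its number of moves. -}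

module Defs where

open import Data.Nat using (ℕ; zero; suc; _+_; _≤_)
open import Data.List using (List; []; _∷_; replicate; map; length)
open import Data.Nat.ListAction using (sum)
open import Data.List.Relation.Unary.All using (All)
open import Data.List.Relation.Unary.Linked using (Linked)
open import Data.List.Relation.Binary.Permutation.Propositional using (_↭_)
open import Data.Product using (Σ; _×_)
open import Relation.Binary.PropositionalEquality using (_≡_)
open import Relation.Nullary using (¬_)

-- Fibonacci numbers with F_1 = 1, F_2 = 2, F_{i+1} = F_i + F_{i-1}.
-- (fib 0 = 1 is a junk value; index 0 never occurs below.)
fib : ℕ → ℕ
fib zero = 1
fib (suc zero) = 1
fib (suc (suc zero)) = 2
fib (suc (suc (suc k))) = fib (suc (suc k)) + fib (suc k)

-- A game state: a multiset of Fibonacci numbers, represented by a list of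
-- their indices (the index i stands for F_i), taken up to permutation.
State : Set
State = List ℕ

initial : ℕ → State
initial n = replicate n 1

data Move : State → State → Set where
  -- (1) F_{i-1}, F_i  ↦  F_{i+1}     (i ≥ 2, i = k + 2)
  combine : ∀ {s t} (k : ℕ) (r : State) →
            s ↭ (suc k ∷ suc (suc k) ∷ r) → t ↭ (suc (suc (suc k)) ∷ r) → Move s t
  split1  : ∀ {s t} (r : State) →
            s ↭ (1 ∷ 1 ∷ r) → t ↭ (2 ∷ r) → Move s t
  split2  : ∀ {s t} (r : State) →
            s ↭ (2 ∷ 2 ∷ r) → t ↭ (1 ∷ 3 ∷ r) → Move s t
  -- (2c) F_i, F_i  ↦  F_{i-2}, F_{i+1}   (i ≥ 3, i = k + 3)
  splitN  : ∀ {s t} (k : ℕ) (r : State) →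
            s ↭ (suc (suc (suc k)) ∷ suc (suc (suc k)) ∷ r) →
            t ↭ (suc k ∷ suc (suc (suc (suc k))) ∷ r) → Move s t

Terminal : State → Set
Terminal s = ∀ t → ¬ Move s t

data Moves : State → State → ℕ → Set where
  done : ∀ {s} → Moves s s 0
  step : ∀ {s t u m} → Move s t → Moves t u m → Moves s u (suc m)

Game : ℕ → ℕ → Set
Game n m = Σ State (λ t → Moves (initial n) t m × Terminal t)

IsZeckendorf : ℕ → List ℕ → Set
IsZeckendorf n zs =
  All (1 ≤_) zs × Linked (λ a b → suc (suc b) ≤ a) zs × sum (map fib zs) ≡ n

IsLargestFibIndex : ℕ → ℕ → Set
IsLargestFibIndex n i = 1 ≤ i × fib i ≤ n × ¬ (fib (suc i) ≤ n)

module Submission where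

-- Along a game
--   * the value Σ F_a is invariant, so it stays n;
--   * the number of parts drops by at most one per move;
--   * the potential Σ a·F_a grows by at least one per move.
-- The potential starts at n and ends at most i·n (no index exceeds i), which
-- bounds every game by i·n moves.  A positive state is terminal exactly when
-- its indices are pairwise at distance ≥ 2; sorted decreasingly such a
-- state is a Zeckendorf decomposition, which is unique, so every final state
-- has Z(n) parts and every game needs at least n − Z(n) moves.  The greedy
-- game, which adds the F_1's one at a time and carries each with merging
-- moves only (every one of them removes a part), attains n − Z(n).

open import Defs
open import Data.Nat using (ℕ; zero; suc; _+_; _*_; _∸_; _≤_; _<_; _≤′_; z≤n; s≤s; z<s; _≟_)
open import Data.Nat.Properties
open import Data.Nat.ListAction using (sum)
open import Data.Nat.ListAction.Properties using (sum-↭; sum-++)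
open import Data.Nat.Tactic.RingSolver using (solve-∀)
open import Data.List using (List; []; _∷_; _++_; length; map)
open import Data.List.Properties using (length-replicate; map-++)
open import Data.List.Relation.Unary.All as All using (All; []; _∷_)
open import Data.List.Relation.Unary.All.Properties as AllP using ()
open import Data.List.Relation.Unary.AllPairs as AllPairs using (AllPairs; []; _∷_)
open import Data.List.Relation.Unary.Linked using (Linked; []; [-]; _∷_; tail)
open import Data.List.Relation.Unary.Linked.Properties using (Linked⇒AllPairs)
open import Data.List.Relation.Binary.Permutation.Propositional
  using (_↭_; refl; prep; swap; ↭-sym; ↭-trans; ↭⇒↭ₛ)
open import Data.List.Relation.Binary.Permutation.Propositional.Properties
  using (All-resp-↭; ↭-length; map⁺; shift)
import Data.List.Relation.Binary.Permutation.Setoid.Properties as PermSetoid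
open import Data.List.Membership.Propositional using (_∈_)
open import Data.List.Membership.Propositional.Properties using (∈-∃++)
import Relation.Binary.Construct.Flip.EqAndOrd as Flip
open import Data.List.Sort (Flip.decTotalOrder ≤-decTotalOrder) using (sort; sort-↭; sort-↗)
open import Data.Product using (Σ; ∃; _×_; _,_)
open import Data.Sum using (_⊎_; inj₁; inj₂)
open import Data.Empty using (⊥-elim)
open import Data.Unit using (⊤; tt)
open import Relation.Nullary using (¬_; yes; no)
open import Relation.Binary using (tri<; tri≈; tri>)
open import Relation.Binary.PropositionalEquality
  using (_≡_; refl; sym; trans; cong; cong₂; subst; subst₂; setoid; resp₂; module ≡-Reasoning)

fib-rec : ∀ k → fib (suc (suc k)) ≡ fib (suc k) + fib k
fib-rec zero = refl
fib-rec (suc k) = refl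

fib-pos : ∀ k → 1 ≤ fib k
fib-pos zero = s≤s z≤n
fib-pos (suc zero) = s≤s z≤n
fib-pos (suc (suc zero)) = s≤s z≤n
fib-pos (suc (suc (suc k))) = ≤-trans (fib-pos (suc (suc k))) (m≤m+n _ _)

fib-mono : ∀ {a b} → a ≤ b → fib a ≤ fib b
fib-mono a≤b = go (≤⇒≤′ a≤b)
  where
  go : ∀ {a b} → a ≤′ b → fib a ≤ fib b
  go (_≤′_.≤′-reflexive refl) = ≤-refl
  go (_≤′_.≤′-step {b} a≤′b) = ≤-trans (go a≤′b) (fib-step b)
    where
    fib-step : ∀ c → fib c ≤ fib (suc c)
    fib-step zero = ≤-refl
    fib-step (suc c) = subst (fib (suc c) ≤_) (sym (fib-rec c)) (m≤m+n _ _)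

total : (ℕ → ℕ) → State → ℕ
total f xs = sum (map f xs)

value : State → ℕ
value = total fib

potential : State → ℕ
potential = total (λ a → a * fib a)

total-↭ : ∀ f {xs ys} → xs ↭ ys → total f xs ≡ total f ys
total-↭ f p = sum-↭ (map⁺ f p)

total-split : ∀ f {s} b r → s ↭ b ++ r → total f s ≡ total f b + total f r
total-split f b r p = trans (total-↭ f p) (trans (cong sum (map-++ f b r)) (sum-++ (map f b) (map f r)))

total-initial : ∀ f → f 1 ≡ 1 → ∀ n → total f (initial n) ≡ n
total-initial f f1 zero = refl
total-initial f f1 (suc n) = cong₂ _+_ f1 (total-initial f f1 n)

Positive : State → Set
Positive = All (1 ≤_)

data Rule : State → State → Set where
  combine : ∀ k → Rule (suc k ∷ suc (suc k) ∷ []) (suc (suc (suc k)) ∷ [])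
  split1  : Rule (1 ∷ 1 ∷ []) (2 ∷ [])
  split2  : Rule (2 ∷ 2 ∷ []) (1 ∷ 3 ∷ [])
  splitN  : ∀ k → Rule (suc (suc (suc k)) ∷ suc (suc (suc k)) ∷ [])
                       (suc k ∷ suc (suc (suc (suc k))) ∷ [])

record InContext (s t : State) : Set where
  constructor in-context
  field
    {before after rest} : State
    rule   : Rule before after
    source : s ↭ before ++ rest
    target : t ↭ after ++ rest

localise : ∀ {s t} → Move s t → InContext s t
localise (combine k r p q) = in-context (combine k) p q
localise (split1 r p q) = in-context split1 p q
localise (split2 r p q) = in-context split2 p q
localise (splitN k r p q) = in-context (splitN k) p q

globalise : ∀ {s t} → InContext s t → Move s t
globalise (in-context (combine k) p q) = combine k _ p q
globalise (in-context split1 p q) = split1 _ p q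
globalise (in-context split2 p q) = split2 _ p q
globalise (in-context (splitN k) p q) = splitN k _ p q

move-cons : ∀ x {s t} → Move s t → Move (x ∷ s) (x ∷ t)
move-cons x mv with localise mv
... | in-context {b} {a} {r} rl p q =
  globalise (in-context rl (↭-trans (prep x p) (↭-sym (shift x b r)))
                           (↭-trans (prep x q) (↭-sym (shift x a r))))

rule-value : ∀ {b a} → Rule b a → value b ≡ value a
rule-value (combine k) = identity (fib (suc k)) (fib (suc (suc k)))
  where
  identity : ∀ p q → p + (q + 0) ≡ (q + p) + 0
  identity = solve-∀
rule-value split1 = refl
rule-value split2 = refl
rule-value (splitN k) rewrite fib-rec k = identity (fib (suc k)) (fib k)
  where
  identity : ∀ p r → (p + r + p) + ((p + r + p) + 0) ≡ p + ((p + r + p + (p + r)) + 0)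
  identity = solve-∀

grows-by : ∀ {x y} g → 1 ≤ g → y ≡ x + g → x < y
grows-by {x} g 1≤g refl = m<m+n x 1≤g

-- The potential grows by an explicit gain: F_{k+1} + F_{k+3} for a
-- combination, 2·F_k + F_{k+1} for the split of F_{k+3}.
rule-potential : ∀ {b a} → Rule b a → potential b < potential a
rule-potential (combine k) =
  grows-by (p + (q + p)) (≤-trans (fib-pos (suc k)) (m≤m+n _ _)) (identity k p q)
  where
  p = fib (suc k)
  q = fib (suc (suc k))
  identity : ∀ k p q → suc (suc (suc k)) * (q + p) + 0
           ≡ (suc k * p + (suc (suc k) * q + 0)) + (p + (q + p))
  identity = solve-∀
rule-potential split1 = grows-by 2 z<s refl
rule-potential split2 = grows-by 2 z<s refl
rule-potential (splitN k) rewrite fib-rec k =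
  grows-by (r + r + p) (≤-trans (fib-pos (suc k)) (m≤n+m _ _)) (identity k p r)
  where
  p = fib (suc k)
  r = fib k
  identity : ∀ k p r →
    suc k * p + (suc (suc (suc (suc k))) * (p + r + p + (p + r)) + 0)
    ≡ (suc (suc (suc k)) * (p + r + p) + (suc (suc (suc k)) * (p + r + p) + 0)) + (r + r + p)
  identity = solve-∀

rule-parts : ∀ {b a} → Rule b a → ∀ r → length (b ++ r) ≤ suc (length (a ++ r))
rule-parts (combine k) r = ≤-refl
rule-parts split1 r = ≤-refl
rule-parts split2 r = n≤1+n _
rule-parts (splitN k) r = n≤1+n _

rule-positive : ∀ {b a} → Rule b a → Positive a
rule-positive (combine k) = s≤s z≤n ∷ []
rule-positive split1 = s≤s z≤n ∷ []
rule-positive split2 = s≤s z≤n ∷ s≤s z≤n ∷ []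
rule-positive (splitN k) = s≤s z≤n ∷ s≤s z≤n ∷ []

move-value : ∀ {s t} → Move s t → value s ≡ value t
move-value {s} {t} mv with localise mv
... | in-context {b} {a} {r} rl p q = begin
  value s            ≡⟨ total-split fib b r p ⟩
  value b + value r  ≡⟨ cong (_+ value r) (rule-value rl) ⟩
  value a + value r  ≡⟨ total-split fib a r q ⟨
  value t            ∎
  where open ≡-Reasoning

move-potential : ∀ {s t} → Move s t → potential s < potential t
move-potential mv with localise mv
... | in-context {b} {a} {r} rl p q =
  subst₂ _<_ (sym (total-split _ b r p)) (sym (total-split _ a r q))
    (+-monoˡ-< (potential r) (rule-potential rl))

move-parts : ∀ {s t} → Move s t → length s ≤ suc (length t)
move-parts mv with localise mv
... | in-context {rest = r} rl p q rewrite ↭-length p | ↭-length q = rule-parts rl r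

move-positive : ∀ {s t} → Positive s → Move s t → Positive t
move-positive pos mv with localise mv
... | in-context {b} rl p q =
  All-resp-↭ (↭-sym q) (AllP.++⁺ (rule-positive rl) (AllP.++⁻ʳ b (All-resp-↭ p pos)))

moves-value : ∀ {s t m} → Moves s t m → value s ≡ value t
moves-value done = refl
moves-value (step mv ms) = trans (move-value mv) (moves-value ms)

moves-potential : ∀ {s t m} → Moves s t m → potential s + m ≤ potential t
moves-potential {s} done = ≤-reflexive (+-identityʳ (potential s))
moves-potential {s} {m = suc m} (step mv ms) = begin
  potential s + suc m  ≡⟨ +-suc (potential s) m ⟩
  suc (potential s) + m ≤⟨ +-monoˡ-≤ m (move-potential mv) ⟩
  _                     ≤⟨ moves-potential ms ⟩
  _                     ∎
  where open ≤-Reasoning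

moves-parts : ∀ {s t m} → Moves s t m → length s ≤ m + length t
moves-parts done = ≤-refl
moves-parts (step mv ms) = ≤-trans (move-parts mv) (s≤s (moves-parts ms))

moves-positive : ∀ {s t m} → Positive s → Moves s t m → Positive t
moves-positive pos done = pos
moves-positive pos (step mv ms) = moves-positive (move-positive pos mv) ms

moves-cons : ∀ x {s t m} → Moves s t m → Moves (x ∷ s) (x ∷ t) m
moves-cons x done = done
moves-cons x (step mv ms) = step (move-cons x mv) (moves-cons x ms)

moves-++ : ∀ {s t u m k} → Moves s t m → Moves t u k → Moves s u (m + k)
moves-++ done ms = ms
moves-++ (step mv ms) ms′ = step mv (moves-++ ms ms′)

game-value : ∀ {n t m} → Moves (initial n) t m → value t ≡ n
game-value {n} ms = trans (sym (moves-value ms)) (total-initial fib refl n)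

game-positive : ∀ {n t m} → Moves (initial n) t m → Positive t
game-positive {n} = moves-positive (initial-positive n)
  where
  initial-positive : ∀ n → Positive (initial n)
  initial-positive zero = []
  initial-positive (suc n) = s≤s z≤n ∷ initial-positive n

potential-≤ : ∀ i xs → All (_≤ i) xs → potential xs ≤ i * value xs
potential-≤ i [] [] = z≤n
potential-≤ i (a ∷ xs) (a≤i ∷ xs≤i) = begin
  a * fib a + potential xs      ≤⟨ +-mono-≤ (*-monoˡ-≤ (fib a) a≤i) (potential-≤ i xs xs≤i) ⟩
  i * fib a + i * value xs      ≡⟨ *-distribˡ-+ i (fib a) (value xs) ⟨
  i * (fib a + value xs)        ∎
  where open ≤-Reasoning

parts-≤-value : ∀ xs → All (λ a → fib a ≤ value xs) xs
parts-≤-value [] = []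
parts-≤-value (x ∷ xs) = m≤m+n _ _ ∷ All.map (λ h → ≤-trans h (m≤n+m _ _)) (parts-≤-value xs)

index-≤ : ∀ {n i a} → IsLargestFibIndex n i → fib a ≤ n → a ≤ i
index-≤ {i = i} {a} (_ , _ , largest) Fa≤n with a ≤? i
... | yes a≤i = a≤i
... | no a≰i = ⊥-elim (largest (≤-trans (fib-mono (≰⇒> a≰i)) Fa≤n))

game-upper : ∀ {n i m} → IsLargestFibIndex n i → Game n m → m ≤ i * n
game-upper {n} {i} {m} largest (t , ms , _) = begin
  m                          ≤⟨ m≤n+m m (potential (initial n)) ⟩
  potential (initial n) + m  ≤⟨ moves-potential ms ⟩
  potential t                ≤⟨ potential-≤ i t (All.map bounded (parts-≤-value t)) ⟩
  i * value t                ≡⟨ cong (i *_) (game-value ms) ⟩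
  i * n                      ∎
  where
  open ≤-Reasoning
  bounded : ∀ {a} → fib a ≤ value t → a ≤ i
  bounded h = index-≤ largest (subst (_ ≤_) (game-value ms) h)

Apart : ℕ → ℕ → Set
Apart a b = suc (suc a) ≤ b ⊎ suc (suc b) ≤ a

Apart-sym : ∀ {a b} → Apart a b → Apart b a
Apart-sym (inj₁ h) = inj₂ h
Apart-sym (inj₂ h) = inj₁ h

apart-↭ : ∀ {xs ys} → xs ↭ ys → AllPairs Apart xs → AllPairs Apart ys
apart-↭ p = PermSetoid.AllPairs-resp-↭ (setoid ℕ) Apart-sym (resp₂ Apart) (↭⇒↭ₛ p)

not-apart : ∀ {x y} → y ≤ suc x → x ≤ suc y → ¬ Apart x y
not-apart y≤1+x _ (inj₁ h) = 1+n≰n (≤-trans h y≤1+x)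
not-apart _ x≤1+y (inj₂ h) = 1+n≰n (≤-trans h x≤1+y)

rule-close : ∀ {b a} → Rule b a → ∀ r → ¬ AllPairs Apart (b ++ r)
rule-close (combine k) r ((apart ∷ _) ∷ _) = not-apart ≤-refl (≤-trans (n≤1+n _) (n≤1+n _)) apart
rule-close split1 r ((apart ∷ _) ∷ _) = not-apart (n≤1+n _) (n≤1+n _) apart
rule-close split2 r ((apart ∷ _) ∷ _) = not-apart (n≤1+n _) (n≤1+n _) apart
rule-close (splitN k) r ((apart ∷ _) ∷ _) = not-apart (n≤1+n _) (n≤1+n _) apart

apart⇒terminal : ∀ {s} → AllPairs Apart s → Terminal s
apart⇒terminal apart t mv with localise mv
... | in-context {rest = r} rl p q = rule-close rl r (apart-↭ p apart)

move-↭ : ∀ {s s′ t} → s ↭ s′ → Move s′ t → Move s t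
move-↭ e mv with localise mv
... | in-context rl p q = globalise (in-context rl (↭-trans e p) q)

adjacent-move : ∀ x r → 1 ≤ x → Σ State (Move (x ∷ suc x ∷ r))
adjacent-move (suc k) r _ = _ , combine k r refl refl

equal-move : ∀ x r → 1 ≤ x → Σ State (Move (x ∷ x ∷ r))
equal-move zero r ()
equal-move 1 r _ = _ , split1 r refl refl
equal-move 2 r _ = _ , split2 r refl refl
equal-move (suc (suc (suc k))) r _ = _ , splitN k r refl refl

stuck : ∀ {s} → Terminal s → ¬ Σ State (Move s)
stuck T (t , mv) = T t mv

terminal-pair : ∀ x y r → 1 ≤ x → 1 ≤ y → Terminal (x ∷ y ∷ r) → Apart x y
terminal-pair x y r px py T with <-cmp x y
... | tri< x<y _ _ with suc x ≟ y
...   | yes refl = ⊥-elim (stuck T (adjacent-move x r px))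
...   | no 1+x≢y = inj₁ (≤∧≢⇒< x<y 1+x≢y)
terminal-pair x y r px py T | tri≈ _ refl _ = ⊥-elim (stuck T (equal-move x r px))
terminal-pair x y r px py T | tri> _ _ y<x with suc y ≟ x
...   | yes refl = ⊥-elim (stuck T (swapped (adjacent-move y r py)))
  where
  swapped : Σ State (Move (y ∷ x ∷ r)) → Σ State (Move (x ∷ y ∷ r))
  swapped (t , mv) = t , move-↭ (swap x y refl) mv
...   | no 1+y≢x = inj₂ (≤∧≢⇒< y<x 1+y≢x)

-- Every pair of parts can be brought to the front, hence all are apart.
terminal⇒apart : ∀ {s} → Positive s → Terminal s → AllPairs Apart s
terminal⇒apart {[]} _ _ = []
terminal⇒apart {x ∷ xs} (px ∷ pxs) T =
  All.tabulate head-apart ∷ terminal⇒apart pxs (λ t mv → T (x ∷ t) (move-cons x mv))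
  where
  head-apart : ∀ {y} → y ∈ xs → Apart x y
  head-apart {y} y∈xs with ∈-∃++ y∈xs
  ... | ys , zs , refl =
    terminal-pair x y (ys ++ zs) px (All.lookup pxs y∈xs)
      (λ t mv → T t (move-↭ (prep x (shift y ys zs)) mv))

Descending : ℕ → ℕ → Set
Descending a b = suc (suc b) ≤ a

zeckendorf-bound : ∀ {x xs} → Positive (x ∷ xs) → Linked Descending (x ∷ xs) →
                   value (x ∷ xs) < fib (suc x)
zeckendorf-bound {suc k} {xs} (_ ∷ pos) linked = begin-strict
  fib (suc k) + value xs  <⟨ +-monoʳ-< (fib (suc k)) (rest-bound xs pos linked) ⟩
  fib (suc k) + fib k     ≡⟨ fib-rec k ⟨
  fib (suc (suc k))       ∎
  where
  open ≤-Reasoning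
  rest-bound : ∀ xs → Positive xs → Linked Descending (suc k ∷ xs) → value xs < fib k
  rest-bound [] _ _ = fib-pos k
  rest-bound (y ∷ ys) pos (s≤s 1+y≤k ∷ linked) =
    <-≤-trans (zeckendorf-bound pos linked) (fib-mono 1+y≤k)

lower-top : ∀ {x xs y ys} → Positive (x ∷ xs) → Linked Descending (x ∷ xs) →
            x < y → value (x ∷ xs) < value (y ∷ ys)
lower-top pos linked x<y =
  <-≤-trans (zeckendorf-bound pos linked) (≤-trans (fib-mono x<y) (m≤m+n _ _))

-- Uniqueness of Zeckendorf decompositions: compare the top indices.
zeckendorf-unique : ∀ {xs ys} → Positive xs → Positive ys →
                    Linked Descending xs → Linked Descending ys → value xs ≡ value ys → xs ≡ ys
zeckendorf-unique {[]} {[]} _ _ _ _ _ = refl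
zeckendorf-unique {[]} {y ∷ _} _ _ _ _ eq = ⊥-elim (<-irrefl eq (≤-trans (fib-pos y) (m≤m+n _ _)))
zeckendorf-unique {x ∷ _} {[]} _ _ _ _ eq = ⊥-elim (<-irrefl (sym eq) (≤-trans (fib-pos x) (m≤m+n _ _)))
zeckendorf-unique {x ∷ xs} {y ∷ ys} px py lx ly eq with <-cmp x y
... | tri< x<y _ _ = ⊥-elim (<-irrefl eq (lower-top {ys = ys} px lx x<y))
... | tri> _ _ y<x = ⊥-elim (<-irrefl (sym eq) (lower-top {ys = xs} py ly y<x))
... | tri≈ _ refl _ =
  cong (x ∷_) (zeckendorf-unique (All.tail px) (All.tail py) (tail lx) (tail ly)
                                 (+-cancelˡ-≡ (fib x) _ _ eq))

sort-apart : ∀ {s} → AllPairs Apart s → Linked Descending (sort s)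
sort-apart {s} apart = descending (sort-↗ s) (apart-↭ (↭-sym (sort-↭ s)) apart)
  where
  descending : ∀ {xs} → Linked (λ a b → b ≤ a) xs → AllPairs Apart xs → Linked Descending xs
  descending [] _ = []
  descending [-] _ = [-]
  descending (_ ∷ sorted) ((inj₂ h ∷ _) ∷ apart) = h ∷ descending sorted apart
  descending (b≤a ∷ _) ((inj₁ h ∷ _) ∷ _) = ⊥-elim (1+n≰n (≤-trans (n≤1+n _) (≤-trans h b≤a)))

apart-parts : ∀ {n t zs} → Positive t → AllPairs Apart t → value t ≡ n →
              IsZeckendorf n zs → length t ≡ length zs
apart-parts {t = t} {zs} pos apart val (zpos , zlinked , zval) = begin
  length t         ≡⟨ ↭-length (sort-↭ t) ⟨
  length (sort t)  ≡⟨ cong length (zeckendorf-unique sorted-pos zpos (sort-apart apart) zlinked same-value) ⟩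
  length zs        ∎
  where
  open ≡-Reasoning
  sorted-pos : Positive (sort t)
  sorted-pos = All-resp-↭ (↭-sym (sort-↭ t)) pos
  same-value : value (sort t) ≡ value zs
  same-value = trans (total-↭ fib (sort-↭ t)) (trans val (sym zval))

-- Lower bound: each move removes at most one part and a game ends with
-- Z(n) parts.
game-lower : ∀ {n zs m} → IsZeckendorf n zs → Game n m → n ∸ length zs ≤ m
game-lower {n} {zs} {m} zeck (t , ms , T) = m≤n+o⇒m∸n≤o n (length zs) (begin
  n                  ≡⟨ length-replicate n ⟨
  length (initial n) ≤⟨ moves-parts ms ⟩
  m + length t       ≡⟨ cong (m +_) (apart-parts pos (terminal⇒apart pos T) (game-value ms) zeck) ⟩
  m + length zs      ≡⟨ +-comm m (length zs) ⟩
  length zs + m      ∎)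
  where
  open ≤-Reasoning
  pos : Positive t
  pos = game-positive ms

-- Its states are ascending Zeckendorf lists; adding a new
-- F_1 in front is resolved by carrying: 1,1 ↦ 2 or F_{j}, F_{j+1} ↦ F_{j+2}
-- repeatedly, each carry being a merging move that removes one part.

Ascending : ℕ → ℕ → Set
Ascending a b = suc (suc a) ≤ b

ascending-trans : ∀ {a b c} → Ascending a b → Ascending b c → Ascending a c
ascending-trans {b = b} a<b b<c = ≤-trans a<b (≤-trans (≤-trans (n≤1+n b) (n≤1+n (suc b))) b<c)

CanPush : ℕ → State → Set
CanPush x [] = ⊤
CanPush x (y ∷ _) = x < y ⊎ (x ≡ 1 × y ≡ 1)

carry-pushable : ∀ {x y Z} → x ≤ suc y → Linked Ascending (y ∷ Z) → CanPush x Z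
carry-pushable {Z = []} _ _ = tt
carry-pushable {Z = _ ∷ _} x≤1+y (y+2≤z ∷ _) = inj₁ (≤-trans (s≤s x≤1+y) y+2≤z)

one-pushable : ∀ Z → Positive Z → CanPush 1 Z
one-pushable [] _ = tt
one-pushable (zero ∷ _) (() ∷ _)
one-pushable (1 ∷ _) _ = inj₂ (refl , refl)
one-pushable (suc (suc _) ∷ _) _ = inj₁ (s≤s (s≤s z≤n))

record GreedyRun (s : State) : Set where
  constructor run
  field
    final     : State
    count     : ℕ
    moves     : Moves s final count
    ascending : Linked Ascending final
    positive  : Positive final
    merging   : count + length final ≡ length s

after : ∀ {s s′ m} → Moves s s′ m → m + length s′ ≡ length s → GreedyRun s′ → GreedyRun s
after {m = m} ms e (run R d ms′ asc pos e′) =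
  run R (m + d) (moves-++ ms ms′) asc pos (trans (+-assoc m d (length R)) (trans (cong (m +_) e′) e))

push : ∀ x Z → 1 ≤ x → Linked Ascending Z → Positive Z → CanPush x Z → GreedyRun (x ∷ Z)
push x [] px _ _ _ = run (x ∷ []) 0 done [-] (px ∷ []) refl
push .1 (.1 ∷ Z) _ asc (_ ∷ pos) (inj₂ (refl , refl)) =
  after (step (split1 Z refl refl) done) refl
        (push 2 Z (s≤s z≤n) (tail asc) pos (carry-pushable ≤-refl asc))
push x (y ∷ Z) px asc (py ∷ pos) (inj₁ x<y) with suc x ≟ y
push (suc k) (.(suc (suc k)) ∷ Z) _ asc (_ ∷ pos) (inj₁ _) | yes refl =
  after (step (combine k Z refl refl) done) refl
        (push (suc (suc (suc k))) Z (s≤s z≤n) (tail asc) pos (carry-pushable ≤-refl asc))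
... | no 1+x≢y = run (x ∷ y ∷ Z) 0 done (≤∧≢⇒< x<y 1+x≢y ∷ asc) (px ∷ py ∷ pos) refl

greedy : ∀ n → GreedyRun (initial n)
greedy zero = run [] 0 done [] [] refl
greedy (suc n) with greedy n
... | run Z m ms asc pos e =
  after (moves-cons 1 ms) (trans (+-suc m (length Z)) (cong suc e))
        (push 1 Z (s≤s z≤n) asc pos (one-pushable Z pos))

greedy-game : ∀ {n zs} → IsZeckendorf n zs → ∃ λ m → Game n m × m ≡ n ∸ length zs
greedy-game {n} {zs} zeck with greedy n
... | run Z m ms asc pos e = m , (Z , ms , apart⇒terminal apart) , (begin
  m                          ≡⟨ m+n∸n≡m m (length Z) ⟨
  m + length Z ∸ length Z    ≡⟨ cong₂ _∸_ (trans e (length-replicate n)) (apart-parts pos apart (game-value ms) zeck) ⟩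
  n ∸ length zs              ∎)
  where
  open ≡-Reasoning
  apart : AllPairs Apart Z
  apart = AllPairs.map inj₁ (Linked⇒AllPairs ascending-trans asc)

theorem1p3 : (n : ℕ) → 1 ≤ n →
    ((zs : List ℕ) → IsZeckendorf n zs →
       ∃ (λ m → Game n m × m ≡ n ∸ length zs) × ((m : ℕ) → Game n m → n ∸ length zs ≤ m))
    × ((i : ℕ) → IsLargestFibIndex n i → (m : ℕ) → Game n m → m ≤ i * n)
theorem1p3 n _ =
  (λ zs zeck → greedy-game zeck , λ m → game-lower zeck) ,
  (λ i largest m → game-upper largest)
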